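{- Let $S=B\sqcup D\subseteq\mathbb{F}_2^n$ be finite with affine basis $B$, $|S|=k$ and $\dim S=d$. Then $\{X_{\vec w}:\vec w\in D\}$ is a basis for $E(S)$, and $\dim E(S)=k-(d+1)$.
   Context: The dimension of $S$ is the dimension of its affine span; an affine basis for $S$ is an affinely independent subset $B\subseteq S$ with the same affine span as $S$ (so $|B|=d+1$). Each $\vec w\in D=S\setminus B$ has a unique expression as a sum $\vec w=\vec b_{i_1}+\dots+\vec b_{i_j}$ of an odd number $j$ of distinct elements of $B$; $X_{\vec w}=\{\vec w,\vec b_{i_1},\dots,\vec b_{i_j}\}$. $E(S)$ is the $\mathbb{F}_2$-subspace of $\mathcal{P}(S)$ (under symmetric difference) of even-size subsets of $S$ summing to $\vec 0$, including $\varnothing$. -}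

module Defs where

open import Data.Nat using (ℕ; zero; suc; _≤_)
open import Data.Nat.Divisibility using (_∣_; _∣?_)
open import Data.Bool using (Bool; true; false; _xor_; if_then_else_)
import Data.Bool.Properties as BoolP
open import Data.Fin using (Fin; zero; suc)
open import Data.Vec using (Vec; []; _∷_; replicate; zipWith)
open import Data.Vec.Properties using (≡-dec)
open import Data.Fin.Subset using (Subset; _∈_; _∉_; _⊆_; ⊥; ⁅_⁆; _∪_; ∁; ∣_∣; inside)
open import Data.Fin.Subset.Properties using (_⊆?_; anySubset?)
open import Data.Product using (Σ; ∃; _×_; _,_)
open import Relation.Nullary using (¬_; Dec; yes; no)
open import Relation.Nullary.Decidable using (_×-dec_; ¬?)
open import Relation.Binary.PropositionalEquality using (_≡_)

F2 : ℕ → Set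
F2 n = Vec Bool n

𝟎 : ∀ {n} → F2 n
𝟎 = replicate _ false

_⊕_ : ∀ {n} → F2 n → F2 n → F2 n
_⊕_ = zipWith _xor_

_≟v_ : ∀ {n} (x y : F2 n) → Dec (x ≡ y)
_≟v_ = ≡-dec BoolP._≟_

-- Sum of the points p i for i ∈ A (A a subset of the index set Fin k).
-- Also used for F₂-linear combinations of subsets (Subset m = Vec Bool m,
-- and ⊕ on subsets is symmetric difference).
sumSub : ∀ {k n} → (Fin k → F2 n) → Subset k → F2 n
sumSub {zero}  p []       = 𝟎
sumSub {suc k} p (b ∷ A) =
  (if b then p zero else 𝟎) ⊕ sumSub (λ i → p (suc i)) A

Even Odd : ℕ → Set
Even m = 2 ∣ m
Odd m = ¬ (2 ∣ m)

-- Affine notions over F₂ for a finite family of points p : Fin k → F₂ⁿ.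
-- (Over F₂ an affine combination is a sum of an odd number of distinct
-- points; an affine dependence is a nonempty even-size subfamily summing
-- to 0.)

InAffSpan : ∀ {k n} → (Fin k → F2 n) → Subset k → F2 n → Set
InAffSpan p T x = ∃ λ A → A ⊆ T × Odd ∣ A ∣ × sumSub p A ≡ x

AffIndepOn : ∀ {k n} → (Fin k → F2 n) → Subset k → Set
AffIndepOn p T = ∀ A → A ⊆ T → Even ∣ A ∣ → sumSub p A ≡ 𝟎 → A ≡ ⊥

AffIndep : ∀ {k n} → (Fin k → F2 n) → Set
AffIndep {k} p = ∀ (A : Subset k) → Even ∣ A ∣ → sumSub p A ≡ 𝟎 → A ≡ ⊥

InAff : ∀ {k n} → (Fin k → F2 n) → F2 n → Set
InAff {k} S x = ∃ λ (A : Subset k) → Odd ∣ A ∣ × sumSub S A ≡ x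

AffDim : ∀ {k n} → (Fin k → F2 n) → ℕ → Set
AffDim {k} {n} S d =
  (Σ (Fin (suc d) → F2 n) λ p → AffIndep p × (∀ j → InAff S (p j)))
  × (∀ m (p : Fin m → F2 n) → AffIndep p → (∀ j → InAff S (p j)) → m ≤ suc d)

IsAffineBasis : ∀ {k n} → (Fin k → F2 n) → Subset k → Set
IsAffineBasis {k} S B =
  AffIndepOn S B × (∀ x → InAffSpan S B x → InAff S x) × (∀ x → InAff S x → InAffSpan S B x)

-- X_w for w = S i, i ∈ D = S ∖ B: {w} together with the (unique) odd set of
-- distinct elements of B summing to w.  Defined by searching all subsets;
-- when i ∉ B and B is an affine basis such a subset exists (and is unique).

ExprSet : ∀ {k n} → (Fin k → F2 n) → Subset k → Fin k → Subset k → Set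
ExprSet S B i C = C ⊆ B × Odd ∣ C ∣ × sumSub S C ≡ S i

X : ∀ {k n} → (Fin k → F2 n) → Subset k → Fin k → Subset k
X S B i with anySubset? (λ C → (C ⊆? B) ×-dec ¬? (2 ∣? ∣ C ∣) ×-dec (sumSub S C ≟v S i))
... | yes (C , _) = ⁅ i ⁆ ∪ C
... | no _        = ⊥

InE : ∀ {k n} → (Fin k → F2 n) → Subset k → Set
InE S A = Even ∣ A ∣ × sumSub S A ≡ 𝟎

XIsBasisOfE : ∀ {k n} → (Fin k → F2 n) → Subset k → Set
XIsBasisOfE {k} S B =
  (∀ i → i ∉ B → InE S (X S B i))
  × (∀ (J : Subset k) → J ⊆ ∁ B → sumSub (X S B) J ≡ ⊥ → J ≡ ⊥)
  × (∀ A → InE S A → ∃ λ (J : Subset k) → J ⊆ ∁ B × sumSub (X S B) J ≡ A)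

HasDim : ∀ {k} → (Subset k → Set) → ℕ → Set
HasDim {k} P m =
  Σ (Fin m → Subset k) λ b →
    (∀ j → P (b j))
    × (∀ (J : Subset m) → sumSub b J ≡ ⊥ → J ≡ ⊥)
    × (∀ A → P A → ∃ λ (J : Subset m) → sumSub b J ≡ A)

module Submission where

-- Homogenise: send each point s to (1, s) ∈ F₂ⁿ⁺¹.  A subfamily A of S then sums to
-- (|A| mod 2, Σ A), so E(S) is the kernel of the linear map A ↦ Σ_{i∈A} (1, s_i),
-- affine independence becomes linear independence, and the affine basis B makes this
-- map injective on subsets of B.  Each X_w lies in the kernel and meets D exactly in
-- {w}; hence the X_w are independent, and removing Σ_{w ∈ A ∩ D} X_w from a kernel
-- element A leaves a kernel element inside B, which must be empty.  Finally
-- |B| = d + 1, because by Gaussian elimination m independent vectors of F₂ᵐ' need m ≤ m'.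

open import Defs
open import Algebra.Bundles using (AbelianGroup)
open import Algebra.Structures using (IsAbelianGroup)
import Algebra.Properties.CommutativeSemigroup as CommutativeSemigroupProperties
import Algebra.Properties.Group as GroupProperties
open import Data.Bool using (Bool; true; false; not; _xor_; if_then_else_; _≟_)
open import Data.Bool.Properties
  using (xor-assoc; xor-comm; xor-identityˡ; xor-identityʳ; xor-same; ∧-distribʳ-xor; ¬-not)
open import Data.Fin using (Fin; zero; suc; punchIn)
open import Data.Fin.Properties using (any?)
open import Data.Fin.Subset using (Subset; ⊥; ⁅_⁆; _∪_; _∩_; ∁; ∣_∣; _∈_; _∉_; _⊆_)
open import Data.Fin.Subset.Properties
  using ( _∈?_; _⊆?_; anySubset?; ∉⊥; drop-∷-⊆; Empty-unique; x∈p∩q⁺; x∈p∩q⁻; p∩q⊆q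
        ; x∈∁p⇒x∉p; x∉p⇒x∈∁p; ∣∁p∣≡n∸∣p∣; ∣⁅x⁆∣≡1; ∩-zeroˡ; ∪-identityˡ)
open import Data.Nat using (ℕ; zero; suc; _∸_; _≤_; z≤n; s≤s)
open import Data.Nat.Divisibility using (_∣_; divides; _∣?_; _∣0; ∣-refl; ∣1⇒≡1; ∣m+n∣m⇒∣n)
open import Data.Nat.Properties using (≤-antisym; m≤n⇒m≤1+n; +-comm)
open import Data.Product using (∃; _×_; _,_; proj₁; proj₂)
open import Data.Vec using ([]; _∷_; head; tail; insertAt; here; there)
open import Data.Vec.Properties
  using (zipWith-assoc; zipWith-comm; zipWith-identityˡ; zipWith-identityʳ; zipWith-distribʳ
        ; ∷-injectiveˡ; ∷-injectiveʳ)
open import Function using (_∘_; id; _⇔_; mk⇔; Equivalence)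
open import Function.Definitions using (Injective)
import Function.Properties.Equivalence as ⇔
open import Relation.Binary.PropositionalEquality
  using (_≡_; refl; sym; trans; cong; cong₂; subst; isEquivalence; module ≡-Reasoning)
open import Relation.Nullary using (¬_; yes; no; contradiction)
open import Relation.Nullary.Decidable using (_×-dec_; ¬?)

open Equivalence using (to; from)
open ≡-Reasoning

private
  variable
    k m n : ℕ

⊕-self : (x : F2 n) → x ⊕ x ≡ 𝟎
⊕-self []      = refl
⊕-self (b ∷ x) = cong₂ _∷_ (xor-same b) (⊕-self x)

⊕-isAbelianGroup : ∀ n → IsAbelianGroup _≡_ (_⊕_ {n}) 𝟎 id
⊕-isAbelianGroup n = record
  { isGroup = record
    { isMonoid = record
      { isSemigroup = record
        { isMagma = record { isEquivalence = isEquivalence ; ∙-cong = cong₂ _⊕_ }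
        ; assoc   = zipWith-assoc xor-assoc
        }
      ; identity = zipWith-identityˡ xor-identityˡ , zipWith-identityʳ xor-identityʳ
      }
    ; inverse = ⊕-self , ⊕-self
    ; ⁻¹-cong = id
    }
  ; comm = zipWith-comm xor-comm
  }

⊕-abelianGroup : ℕ → AbelianGroup _ _
⊕-abelianGroup n = record { isAbelianGroup = ⊕-isAbelianGroup n }

module _ {n : ℕ} where
  open AbelianGroup (⊕-abelianGroup n) public
    using () renaming (identityˡ to ⊕-identityˡ; identityʳ to ⊕-identityʳ; comm to ⊕-comm)
  open CommutativeSemigroupProperties (AbelianGroup.commutativeSemigroup (⊕-abelianGroup n)) public
    using () renaming (interchange to ⊕-interchange; x∙yz≈y∙xz to ⊕-swap)
  open GroupProperties (AbelianGroup.group (⊕-abelianGroup n)) public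
    using () renaming (inverseˡ-unique to ⊕≡𝟎⇒≡)

infixr 30 _·_
_·_ : Bool → F2 n → F2 n
b · v = if b then v else 𝟎

·-distribʳ-xor : ∀ a b (v : F2 n) → (a xor b) · v ≡ a · v ⊕ b · v
·-distribʳ-xor true  true  v = sym (⊕-self v)
·-distribʳ-xor true  false v = sym (⊕-identityʳ v)
·-distribʳ-xor false b     v = sym (⊕-identityˡ (b · v))

·-distribˡ-⊕ : ∀ b (x y : F2 n) → b · (x ⊕ y) ≡ b · x ⊕ b · y
·-distribˡ-⊕ true  x y = refl
·-distribˡ-⊕ false x y = sym (⊕-identityˡ 𝟎)

IsLinear : (F2 m → F2 n) → Set
IsLinear f = f 𝟎 ≡ 𝟎 × (∀ x y → f (x ⊕ y) ≡ f x ⊕ f y)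

linear-· : {f : F2 m → F2 n} → IsLinear f → ∀ b v → f (b · v) ≡ b · f v
linear-· _         true  v = refl
linear-· (f𝟎≡𝟎 , _) false v = f𝟎≡𝟎

linear-sumSub : {f : F2 m → F2 n} → IsLinear f →
                (c : Fin k → F2 m) (J : Subset k) → f (sumSub c J) ≡ sumSub (f ∘ c) J
linear-sumSub (f𝟎≡𝟎 , _) c [] = f𝟎≡𝟎
linear-sumSub {f = f} linear@(_ , f-⊕) c (b ∷ J) = begin
  f (b · c zero ⊕ sumSub (c ∘ suc) J)      ≡⟨ f-⊕ _ _ ⟩
  f (b · c zero) ⊕ f (sumSub (c ∘ suc) J)  ≡⟨ cong₂ _⊕_ (linear-· linear b (c zero))
                                                       (linear-sumSub linear (c ∘ suc) J) ⟩
  b · f (c zero) ⊕ sumSub (f ∘ c ∘ suc) J  ∎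

false∷-isLinear : IsLinear (λ (x : F2 n) → false ∷ x)
false∷-isLinear = refl , λ _ _ → refl

sumSub-⊥ : (p : Fin k → F2 n) → sumSub p ⊥ ≡ 𝟎
sumSub-⊥ {zero}  p = refl
sumSub-⊥ {suc k} p = trans (⊕-identityˡ _) (sumSub-⊥ (p ∘ suc))

sumSub-⊕ : (p : Fin k → F2 n) (A A′ : Subset k) → sumSub p (A ⊕ A′) ≡ sumSub p A ⊕ sumSub p A′
sumSub-⊕ p []      []        = sym (⊕-identityˡ 𝟎)
sumSub-⊕ p (a ∷ A) (a′ ∷ A′) = begin
  (a xor a′) · p zero ⊕ sumSub (p ∘ suc) (A ⊕ A′)
    ≡⟨ cong₂ _⊕_ (·-distribʳ-xor a a′ (p zero)) (sumSub-⊕ (p ∘ suc) A A′) ⟩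
  (a · p zero ⊕ a′ · p zero) ⊕ (sumSub (p ∘ suc) A ⊕ sumSub (p ∘ suc) A′)
    ≡⟨ ⊕-interchange _ _ _ _ ⟩
  (a · p zero ⊕ sumSub (p ∘ suc) A) ⊕ (a′ · p zero ⊕ sumSub (p ∘ suc) A′) ∎

sumSub-isLinear : (p : Fin k → F2 n) → IsLinear (sumSub p)
sumSub-isLinear p = sumSub-⊥ p , sumSub-⊕ p

sumSub-sumSub : (p : Fin k → F2 n) (c : Fin m → Subset k) (J : Subset m) →
                sumSub p (sumSub c J) ≡ sumSub (sumSub p ∘ c) J
sumSub-sumSub p = linear-sumSub (sumSub-isLinear p)

sumSub-pointwise-⊕ : (c c′ : Fin k → F2 n) (J : Subset k) →
                     sumSub (λ j → c j ⊕ c′ j) J ≡ sumSub c J ⊕ sumSub c′ J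
sumSub-pointwise-⊕ c c′ []      = sym (⊕-identityˡ 𝟎)
sumSub-pointwise-⊕ c c′ (b ∷ J) = begin
  b · (c zero ⊕ c′ zero) ⊕ sumSub (λ j → c (suc j) ⊕ c′ (suc j)) J
    ≡⟨ cong₂ _⊕_ (·-distribˡ-⊕ b (c zero) (c′ zero)) (sumSub-pointwise-⊕ (c ∘ suc) (c′ ∘ suc) J) ⟩
  (b · c zero ⊕ b · c′ zero) ⊕ (sumSub (c ∘ suc) J ⊕ sumSub (c′ ∘ suc) J)
    ≡⟨ ⊕-interchange _ _ _ _ ⟩
  (b · c zero ⊕ sumSub (c ∘ suc) J) ⊕ (b · c′ zero ⊕ sumSub (c′ ∘ suc) J) ∎

sumSub-cong : (c c′ : Fin k → F2 n) (J : Subset k) →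
              (∀ {j} → j ∈ J → c j ≡ c′ j) → sumSub c J ≡ sumSub c′ J
sumSub-cong c c′ []          _  = refl
sumSub-cong c c′ (true ∷ J)  eq =
  cong₂ _⊕_ (eq here) (sumSub-cong (c ∘ suc) (c′ ∘ suc) J (eq ∘ there))
sumSub-cong c c′ (false ∷ J) eq =
  cong (𝟎 ⊕_) (sumSub-cong (c ∘ suc) (c′ ∘ suc) J (eq ∘ there))

sumSub-𝟎 : (J : Subset k) → sumSub (λ _ → 𝟎 {n}) J ≡ 𝟎
sumSub-𝟎 []          = refl
sumSub-𝟎 (true ∷ J)  = trans (⊕-identityˡ _) (sumSub-𝟎 J)
sumSub-𝟎 (false ∷ J) = trans (⊕-identityˡ _) (sumSub-𝟎 J)

sumSub-⁅⁆ : (p : Fin k → F2 n) (i : Fin k) → sumSub p ⁅ i ⁆ ≡ p i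
sumSub-⁅⁆ p zero    = trans (cong (p zero ⊕_) (sumSub-⊥ (p ∘ suc))) (⊕-identityʳ (p zero))
sumSub-⁅⁆ p (suc i) = trans (⊕-identityˡ _) (sumSub-⁅⁆ (p ∘ suc) i)

sumSub-singletons : (J : Subset k) → sumSub ⁅_⁆ J ≡ J
sumSub-singletons []      = refl
sumSub-singletons (b ∷ J) = begin
  b · ⁅ zero ⁆ ⊕ sumSub (λ i → false ∷ ⁅ i ⁆) J ≡⟨ cong (b · ⁅ zero ⁆ ⊕_) (sym (linear-sumSub false∷-isLinear ⁅_⁆ J)) ⟩
  b · ⁅ zero ⁆ ⊕ (false ∷ sumSub ⁅_⁆ J)        ≡⟨ cong (λ K → b · ⁅ zero ⁆ ⊕ (false ∷ K)) (sumSub-singletons J) ⟩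
  b · ⁅ zero ⁆ ⊕ (false ∷ J)                   ≡⟨ head-only b ⟩
  b ∷ J                                        ∎
  where
  head-only : ∀ b → b · ⁅ zero ⁆ ⊕ (false ∷ J) ≡ b ∷ J
  head-only true  = cong (true ∷_) (⊕-identityˡ J)
  head-only false = cong (false ∷_) (⊕-identityˡ J)

parity : Subset k → Bool
parity []      = false
parity (b ∷ A) = b xor parity A

2∣⇒2∣2+ : ∀ {m} → 2 ∣ m → 2 ∣ suc (suc m)
2∣⇒2∣2+ (divides q eq) = divides (suc q) (cong (λ m → suc (suc m)) eq)

odd⇒even-suc : ∀ m → Odd m → Even (suc m)
odd⇒even-suc zero          odd = contradiction (2 ∣0) odd
odd⇒even-suc (suc zero)    odd = ∣-refl
odd⇒even-suc (suc (suc m)) odd = 2∣⇒2∣2+ (odd⇒even-suc m (odd ∘ 2∣⇒2∣2+))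

even-suc⇔odd : ∀ m → Even (suc m) ⇔ Odd m
even-suc⇔odd m = mk⇔ not-both (odd⇒even-suc m)
  where
  not-both : Even (suc m) → Odd m
  not-both e e′ with ∣1⇒≡1 (∣m+n∣m⇒∣n (subst (2 ∣_) (+-comm 1 m) e) e′)
  ... | ()

odd⇔≡true : ∀ {m} {b : Bool} → Even m ⇔ b ≡ false → Odd m ⇔ b ≡ true
odd⇔≡true {b = b} even⇔ =
  mk⇔ (λ odd → ¬-not (odd ∘ from even⇔)) (λ b≡true → not-false b≡true ∘ to even⇔)
  where
  not-false : b ≡ true → ¬ b ≡ false
  not-false refl ()

not≡false⇔≡true : ∀ {b} → not b ≡ false ⇔ b ≡ true
not≡false⇔≡true {true}  = mk⇔ (λ _ → refl) (λ _ → refl)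
not≡false⇔≡true {false} = mk⇔ (λ ()) (λ ())

even⇔parity≡false : (A : Subset k) → Even ∣ A ∣ ⇔ parity A ≡ false
even⇔parity≡false []          = mk⇔ (λ _ → refl) (λ _ → 2 ∣0)
even⇔parity≡false (false ∷ A) = even⇔parity≡false A
even⇔parity≡false (true ∷ A)  =
  ⇔.trans (even-suc⇔odd ∣ A ∣)
    (⇔.trans (odd⇔≡true (even⇔parity≡false A)) (⇔.sym not≡false⇔≡true))

odd⇔parity≡true : (A : Subset k) → Odd ∣ A ∣ ⇔ parity A ≡ true
odd⇔parity≡true A = odd⇔≡true (even⇔parity≡false A)

odd-⁅⁆ : (i : Fin k) → Odd ∣ ⁅ i ⁆ ∣
odd-⁅⁆ i rewrite ∣⁅x⁆∣≡1 i = λ 2∣1 → contradiction (∣1⇒≡1 2∣1) λ ()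

homogenise : (Fin k → F2 n) → Fin k → F2 (suc n)
homogenise p i = true ∷ p i

sumSub-homogenise : (p : Fin k → F2 n) (A : Subset k) →
                    sumSub (homogenise p) A ≡ parity A ∷ sumSub p A
sumSub-homogenise p []          = refl
sumSub-homogenise p (true ∷ A)  = cong ((true ∷ p zero) ⊕_) (sumSub-homogenise (p ∘ suc) A)
sumSub-homogenise p (false ∷ A) = cong (𝟎 ⊕_) (sumSub-homogenise (p ∘ suc) A)

InE⇔kernel : (S : Fin k → F2 n) (A : Subset k) → InE S A ⇔ sumSub (homogenise S) A ≡ 𝟎
InE⇔kernel S A = mk⇔
  (λ (even , sum≡𝟎) → trans (sumSub-homogenise S A)
                             (cong₂ _∷_ (to (even⇔parity≡false A) even) sum≡𝟎))
  (λ kernel → let split = trans (sym (sumSub-homogenise S A)) kernel in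
              from (even⇔parity≡false A) (∷-injectiveˡ split) , ∷-injectiveʳ split)

homogeneousSum-odd : (S : Fin k → F2 n) {C : Subset k} {x : F2 n} →
                     Odd ∣ C ∣ → sumSub S C ≡ x → sumSub (homogenise S) C ≡ true ∷ x
homogeneousSum-odd S {C} odd sum≡x =
  trans (sumSub-homogenise S C) (cong₂ _∷_ (to (odd⇔parity≡true C) odd) sum≡x)

Independent : (Fin m → F2 n) → Set
Independent {m} c = ∀ (J : Subset m) → sumSub c J ≡ 𝟎 → J ≡ ⊥

IndependentOn : (Fin k → F2 n) → Subset k → Set
IndependentOn c T = ∀ A → A ⊆ T → sumSub c A ≡ 𝟎 → A ≡ ⊥

affIndep⇔independent : (p : Fin m → F2 n) → AffIndep p ⇔ Independent (homogenise p)
affIndep⇔independent p = mk⇔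
  (λ indep J kernel → let even , sum≡𝟎 = from (InE⇔kernel p J) kernel in indep J even sum≡𝟎)
  (λ indep J even sum≡𝟎 → indep J (to (InE⇔kernel p J) (even , sum≡𝟎)))

affIndepOn⇒independentOn : (p : Fin k → F2 n) {T : Subset k} →
                           AffIndepOn p T → IndependentOn (homogenise p) T
affIndepOn⇒independentOn p indep A A⊆T kernel =
  let even , sum≡𝟎 = from (InE⇔kernel p A) kernel in indep A A⊆T even sum≡𝟎

independent-factor : {p : Fin m → F2 n} (q : Fin k → F2 n) (c : Fin m → Subset k) →
                     (∀ j → p j ≡ sumSub q (c j)) → Independent p → Independent c
independent-factor {p = p} q c p≡ indep J sum≡𝟎 = indep J (begin
  sumSub p J               ≡⟨ sumSub-cong p (sumSub q ∘ c) J (λ {j} _ → p≡ j) ⟩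
  sumSub (sumSub q ∘ c) J  ≡⟨ sym (sumSub-sumSub q c J) ⟩
  sumSub q (sumSub c J)    ≡⟨ cong (sumSub q) sum≡𝟎 ⟩
  sumSub q ⊥               ≡⟨ sumSub-⊥ q ⟩
  𝟎                        ∎)

sumSub-insertAt : (f : Fin (suc m) → F2 n) (i : Fin (suc m)) (β : Bool) (J : Subset m) →
                  sumSub f (insertAt J i β) ≡ β · f i ⊕ sumSub (f ∘ punchIn i) J
sumSub-insertAt f zero    β J       = refl
sumSub-insertAt f (suc i) β (b ∷ J) =
  trans (cong (b · f zero ⊕_) (sumSub-insertAt (f ∘ suc) i β J)) (⊕-swap _ _ _)

insertAt≡⊥ : (J : Subset m) (i : Fin (suc m)) (β : Bool) → insertAt J i β ≡ ⊥ → J ≡ ⊥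
insertAt≡⊥ J       zero    β eq = ∷-injectiveʳ eq
insertAt≡⊥ (b ∷ J) (suc i) β eq = cong₂ _∷_ (∷-injectiveˡ eq) (insertAt≡⊥ J i β (∷-injectiveʳ eq))

sumSub-multiples : (g : Fin m → Bool) (v : F2 n) (J : Subset m) →
                   ∃ λ β → sumSub (λ j → g j · v) J ≡ β · v
sumSub-multiples g v []          = false , refl
sumSub-multiples g v (false ∷ J) =
  let β , sum≡ = sumSub-multiples (g ∘ suc) v J in β , trans (⊕-identityˡ _) sum≡
sumSub-multiples g v (true ∷ J)  =
  let β , sum≡ = sumSub-multiples (g ∘ suc) v J in
  g zero xor β , trans (cong (g zero · v ⊕_) sum≡) (sym (·-distribʳ-xor (g zero) β v))

eliminate : (Fin (suc m) → F2 (suc n)) → Fin (suc m) → Fin m → F2 (suc n)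
eliminate c j₀ j = c (punchIn j₀ j) ⊕ head (c (punchIn j₀ j)) · c j₀

-- A vanishing combination of the eliminated vectors is one of c, with coefficient β at j₀.
independent-eliminate : (c : Fin (suc m) → F2 (suc n)) (j₀ : Fin (suc m)) →
                        Independent c → Independent (eliminate c j₀)
independent-eliminate c j₀ indep J sum≡𝟎 =
  let β , multiples≡ = sumSub-multiples (head ∘ c ∘ punchIn j₀) (c j₀) J in
  insertAt≡⊥ J j₀ β (indep (insertAt J j₀ β) (begin
    sumSub c (insertAt J j₀ β)                    ≡⟨ sumSub-insertAt c j₀ β J ⟩
    β · c j₀ ⊕ sumSub (c ∘ punchIn j₀) J          ≡⟨ ⊕-comm _ _ ⟩
    sumSub (c ∘ punchIn j₀) J ⊕ β · c j₀          ≡⟨ cong (sumSub (c ∘ punchIn j₀) J ⊕_) (sym multiples≡) ⟩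
    sumSub (c ∘ punchIn j₀) J
      ⊕ sumSub (λ j → head (c (punchIn j₀ j)) · c j₀) J
                                                  ≡⟨ sym (sumSub-pointwise-⊕ _ _ J) ⟩
    sumSub (eliminate c j₀) J                     ≡⟨ sum≡𝟎 ⟩
    𝟎                                             ∎))

head-eliminate : (c : Fin (suc m) → F2 (suc n)) (j₀ : Fin (suc m)) →
                 head (c j₀) ≡ true → ∀ j → head (eliminate c j₀ j) ≡ false
head-eliminate c j₀ pivot j = clears (c (punchIn j₀ j)) (c j₀) pivot
  where
  clears : (x v : F2 (suc n)) → head v ≡ true → head (x ⊕ head x · v) ≡ false
  clears (true ∷ x)  (true ∷ v)  _  = refl
  clears (true ∷ x)  (false ∷ v) ()
  clears (false ∷ x) v           _  = refl

independent-tail : (c : Fin m → F2 (suc n)) → (∀ j → head (c j) ≡ false) →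
                   Independent c → Independent (tail ∘ c)
independent-tail c heads indep J sum≡𝟎 = indep J (begin
  sumSub c J                          ≡⟨ sumSub-cong c _ J (λ {j} _ → split (c j) (heads j)) ⟩
  sumSub (λ j → false ∷ tail (c j)) J  ≡⟨ sym (linear-sumSub false∷-isLinear (tail ∘ c) J) ⟩
  false ∷ sumSub (tail ∘ c) J          ≡⟨ cong (false ∷_) sum≡𝟎 ⟩
  𝟎                                   ∎)
  where
  split : (x : F2 (suc n)) → head x ≡ false → x ≡ false ∷ tail x
  split (false ∷ x) _ = refl

F2⁰-trivial : (v : F2 0) → v ≡ 𝟎
F2⁰-trivial [] = refl

independent⇒≤ : (c : Fin m → F2 n) → Independent c → m ≤ n
independent⇒≤ {zero}          c indep = z≤n
independent⇒≤ {suc m} {zero}  c indep with indep ⁅ zero ⁆ (F2⁰-trivial _)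
... | ()
independent⇒≤ {suc m} {suc n} c indep with any? (λ j → head (c j) ≟ true)
... | yes (j₀ , pivot) =
  s≤s (independent⇒≤ (tail ∘ eliminate c j₀)
        (independent-tail _ (head-eliminate c j₀ pivot) (independent-eliminate c j₀ indep)))
... | no no-pivot =
  m≤n⇒m≤1+n (independent⇒≤ (tail ∘ c)
              (independent-tail c (λ j → ¬-not (λ pivot → no-pivot (j , pivot))) indep))

enumerate : (T : Subset k) → Fin ∣ T ∣ → Fin k
enumerate (true ∷ T)  zero    = zero
enumerate (true ∷ T)  (suc j) = suc (enumerate T j)
enumerate (false ∷ T) j       = suc (enumerate T j)

image : (T : Subset k) → Subset ∣ T ∣ → Subset k
image []          []      = []
image (true ∷ T)  (b ∷ J) = b ∷ image T J
image (false ∷ T) J       = false ∷ image T J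

restrict : (T : Subset k) → Subset k → Subset ∣ T ∣
restrict []          []      = []
restrict (true ∷ T)  (b ∷ A) = b ∷ restrict T A
restrict (false ∷ T) (_ ∷ A) = restrict T A

enumerate-∈ : (T : Subset k) (j : Fin ∣ T ∣) → enumerate T j ∈ T
enumerate-∈ (true ∷ T)  zero    = here
enumerate-∈ (true ∷ T)  (suc j) = there (enumerate-∈ T j)
enumerate-∈ (false ∷ T) j       = there (enumerate-∈ T j)

image-⊆ : (T : Subset k) (J : Subset ∣ T ∣) → image T J ⊆ T
image-⊆ (true ∷ T)  (true ∷ J) here       = here
image-⊆ (true ∷ T)  (_ ∷ J)    (there x∈) = there (image-⊆ T J x∈)
image-⊆ (false ∷ T) J          (there x∈) = there (image-⊆ T J x∈)

image≡⊥ : (T : Subset k) (J : Subset ∣ T ∣) → image T J ≡ ⊥ → J ≡ ⊥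
image≡⊥ []          []      eq = refl
image≡⊥ (true ∷ T)  (b ∷ J) eq = cong₂ _∷_ (∷-injectiveˡ eq) (image≡⊥ T J (∷-injectiveʳ eq))
image≡⊥ (false ∷ T) J       eq = image≡⊥ T J (∷-injectiveʳ eq)

image-restrict : (T : Subset k) {A : Subset k} → A ⊆ T → image T (restrict T A) ≡ A
image-restrict []          {[]}        _   = refl
image-restrict (true ∷ T)  {b ∷ A}     A⊆T = cong (b ∷_) (image-restrict T (drop-∷-⊆ A⊆T))
image-restrict (false ∷ T) {false ∷ A} A⊆T = cong (false ∷_) (image-restrict T (drop-∷-⊆ A⊆T))
image-restrict (false ∷ T) {true ∷ A}  A⊆T with A⊆T here
... | ()

sumSub-image : (f : Fin k → F2 n) (T : Subset k) (J : Subset ∣ T ∣) →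
               sumSub f (image T J) ≡ sumSub (f ∘ enumerate T) J
sumSub-image f []          []      = refl
sumSub-image f (true ∷ T)  (b ∷ J) = cong (b · f zero ⊕_) (sumSub-image (f ∘ suc) T J)
sumSub-image f (false ∷ T) J       = trans (⊕-identityˡ _) (sumSub-image (f ∘ suc) T J)

sumSub-restrict : (f : Fin k → F2 n) (T : Subset k) {A : Subset k} → A ⊆ T →
                  sumSub f A ≡ sumSub (f ∘ enumerate T) (restrict T A)
sumSub-restrict f T {A} A⊆T = begin
  sumSub f A                                ≡⟨ cong (sumSub f) (sym (image-restrict T A⊆T)) ⟩
  sumSub f (image T (restrict T A))         ≡⟨ sumSub-image f T (restrict T A) ⟩
  sumSub (f ∘ enumerate T) (restrict T A)   ∎

independentOn⇒independent : (c : Fin k → F2 n) (T : Subset k) →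
                            IndependentOn c T → Independent (c ∘ enumerate T)
independentOn⇒independent c T indep J sum≡𝟎 =
  image≡⊥ T J (indep (image T J) (image-⊆ T J) (trans (sumSub-image c T J) sum≡𝟎))

∩-isLinear : (M : Subset k) → IsLinear (_∩ M)
∩-isLinear M = ∩-zeroˡ M , λ A A′ → zipWith-distribʳ ∧-distribʳ-xor M A A′

⊆⇒∩∁≡⊥ : {A B : Subset k} → A ⊆ B → A ∩ ∁ B ≡ ⊥
⊆⇒∩∁≡⊥ {A = A} {B} A⊆B = Empty-unique λ (x , x∈A∩∁B) →
  let x∈A , x∈∁B = x∈p∩q⁻ A (∁ B) x∈A∩∁B in x∈∁p⇒x∉p x∈∁B (A⊆B x∈A)

∩∁≡⊥⇒⊆ : {A B : Subset k} → A ∩ ∁ B ≡ ⊥ → A ⊆ B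
∩∁≡⊥⇒⊆ {B = B} eq {x} x∈A with x ∈? B
... | yes x∈B = x∈B
... | no  x∉B = contradiction (subst (x ∈_) eq (x∈p∩q⁺ (x∈A , x∉p⇒x∈∁p x∉B))) ∉⊥

⁅⁆∩ : {i : Fin k} {M : Subset k} → i ∈ M → ⁅ i ⁆ ∩ M ≡ ⁅ i ⁆
⁅⁆∩ {i = zero}  {true ∷ M} here       = cong (true ∷_) (∩-zeroˡ M)
⁅⁆∩ {i = suc i} {_ ∷ M}    (there i∈) = cong (false ∷_) (⁅⁆∩ i∈)

⁅⁆∪≡⁅⁆⊕ : (i : Fin k) (C : Subset k) → i ∉ C → ⁅ i ⁆ ∪ C ≡ ⁅ i ⁆ ⊕ C
⁅⁆∪≡⁅⁆⊕ zero    (true ∷ C)  i∉C = contradiction here i∉C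
⁅⁆∪≡⁅⁆⊕ zero    (false ∷ C) _   = cong (true ∷_) (trans (∪-identityˡ C) (sym (⊕-identityˡ C)))
⁅⁆∪≡⁅⁆⊕ (suc i) (b ∷ C)     i∉C = cong (b ∷_) (⁅⁆∪≡⁅⁆⊕ i C (i∉C ∘ there))

-- A family Y indexed by the complement of B, with Y i ∩ ∁ B = {i}, is a basis of the kernel
-- of A ↦ Σ_{a ∈ A} h a as soon as that map is injective on subsets of B.
module KernelBasis
  (h : Fin k → F2 n) (B : Subset k) (independentOnB : IndependentOn h B)
  (Y : Fin k → Subset k)
  (Y-kernel : ∀ i → i ∉ B → sumSub h (Y i) ≡ 𝟎)
  (Y-coordinate : ∀ i → i ∉ B → Y i ∩ ∁ B ≡ ⁅ i ⁆)
  where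

  coordinates : (J : Subset k) → J ⊆ ∁ B → sumSub Y J ∩ ∁ B ≡ J
  coordinates J J⊆∁B = begin
    sumSub Y J ∩ ∁ B             ≡⟨ linear-sumSub (∩-isLinear (∁ B)) Y J ⟩
    sumSub (λ j → Y j ∩ ∁ B) J   ≡⟨ sumSub-cong _ ⁅_⁆ J (λ j∈J → Y-coordinate _ (x∈∁p⇒x∉p (J⊆∁B j∈J))) ⟩
    sumSub ⁅_⁆ J                 ≡⟨ sumSub-singletons J ⟩
    J                            ∎

  independent : (J : Subset k) → J ⊆ ∁ B → sumSub Y J ≡ ⊥ → J ≡ ⊥
  independent J J⊆∁B sum≡⊥ = begin
    J                  ≡⟨ sym (coordinates J J⊆∁B) ⟩
    sumSub Y J ∩ ∁ B   ≡⟨ cong (_∩ ∁ B) sum≡⊥ ⟩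
    ⊥ ∩ ∁ B            ≡⟨ ∩-zeroˡ (∁ B) ⟩
    ⊥                  ∎

  sum-kernel : (J : Subset k) → J ⊆ ∁ B → sumSub h (sumSub Y J) ≡ 𝟎
  sum-kernel J J⊆∁B = begin
    sumSub h (sumSub Y J)     ≡⟨ sumSub-sumSub h Y J ⟩
    sumSub (sumSub h ∘ Y) J   ≡⟨ sumSub-cong _ _ J (λ j∈J → Y-kernel _ (x∈∁p⇒x∉p (J⊆∁B j∈J))) ⟩
    sumSub (λ _ → 𝟎) J        ≡⟨ sumSub-𝟎 J ⟩
    𝟎                         ∎

  spans : (A : Subset k) → sumSub h A ≡ 𝟎 → sumSub Y (A ∩ ∁ B) ≡ A
  spans A A-kernel = sym (⊕≡𝟎⇒≡ A (sumSub Y J) (independentOnB residue residue⊆B residue-kernel))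
    where
    J = A ∩ ∁ B
    J⊆∁B = p∩q⊆q A (∁ B)
    residue = A ⊕ sumSub Y J

    residue⊆B : residue ⊆ B
    residue⊆B = ∩∁≡⊥⇒⊆ (begin
      residue ∩ ∁ B                   ≡⟨ proj₂ (∩-isLinear (∁ B)) A (sumSub Y J) ⟩
      J ⊕ (sumSub Y J ∩ ∁ B)          ≡⟨ cong (J ⊕_) (coordinates J J⊆∁B) ⟩
      J ⊕ J                           ≡⟨ ⊕-self J ⟩
      ⊥                               ∎)

    residue-kernel : sumSub h residue ≡ 𝟎
    residue-kernel = begin
      sumSub h residue                       ≡⟨ sumSub-⊕ h A (sumSub Y J) ⟩
      sumSub h A ⊕ sumSub h (sumSub Y J)     ≡⟨ cong₂ _⊕_ A-kernel (sum-kernel J J⊆∁B) ⟩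
      𝟎 ⊕ 𝟎                                  ≡⟨ ⊕-self 𝟎 ⟩
      𝟎                                      ∎

expression : (S : Fin k → F2 n) (B : Subset k) → IsAffineBasis S B → ∀ i → ∃ (ExprSet S B i)
expression S B (_ , _ , inSpan) i = inSpan (S i) (⁅ i ⁆ , odd-⁅⁆ i , sumSub-⁅⁆ S i)

X≡⁅⁆∪ : (S : Fin k → F2 n) (B : Subset k) (i : Fin k) →
        ∃ (ExprSet S B i) → ∃ λ C → ExprSet S B i C × X S B i ≡ ⁅ i ⁆ ∪ C
X≡⁅⁆∪ S B i ∃C with anySubset? (λ C → (C ⊆? B) ×-dec ¬? (2 ∣? ∣ C ∣) ×-dec (sumSub S C ≟v S i))
... | yes (C , C-expr) = C , C-expr , refl
... | no  ∄C           = contradiction ∃C ∄C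

X≡⁅⁆⊕ : (S : Fin k → F2 n) (B : Subset k) → IsAffineBasis S B → ∀ i → i ∉ B →
        ∃ λ C → ExprSet S B i C × X S B i ≡ ⁅ i ⁆ ⊕ C
X≡⁅⁆⊕ S B basis i i∉B =
  let C , C-expr@(C⊆B , _) , X≡ = X≡⁅⁆∪ S B i (expression S B basis i) in
  C , C-expr , trans X≡ (⁅⁆∪≡⁅⁆⊕ i C (i∉B ∘ C⊆B))

X-kernel : (S : Fin k → F2 n) (B : Subset k) → IsAffineBasis S B →
           ∀ i → i ∉ B → sumSub (homogenise S) (X S B i) ≡ 𝟎
X-kernel S B basis i i∉B =
  let C , (_ , odd , sum≡) , X≡ = X≡⁅⁆⊕ S B basis i i∉B in begin
    sumSub (homogenise S) (X S B i)                         ≡⟨ cong (sumSub (homogenise S)) X≡ ⟩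
    sumSub (homogenise S) (⁅ i ⁆ ⊕ C)                       ≡⟨ sumSub-⊕ (homogenise S) ⁅ i ⁆ C ⟩
    sumSub (homogenise S) ⁅ i ⁆ ⊕ sumSub (homogenise S) C   ≡⟨ cong₂ _⊕_ (sumSub-⁅⁆ (homogenise S) i)
                                                                        (homogeneousSum-odd S odd sum≡) ⟩
    homogenise S i ⊕ homogenise S i                         ≡⟨ ⊕-self (homogenise S i) ⟩
    𝟎                                                       ∎

X-coordinate : (S : Fin k → F2 n) (B : Subset k) → IsAffineBasis S B →
               ∀ i → i ∉ B → X S B i ∩ ∁ B ≡ ⁅ i ⁆
X-coordinate S B basis i i∉B =
  let C , (C⊆B , _) , X≡ = X≡⁅⁆⊕ S B basis i i∉B in begin
    X S B i ∩ ∁ B                   ≡⟨ cong (_∩ ∁ B) X≡ ⟩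
    (⁅ i ⁆ ⊕ C) ∩ ∁ B               ≡⟨ proj₂ (∩-isLinear (∁ B)) ⁅ i ⁆ C ⟩
    (⁅ i ⁆ ∩ ∁ B) ⊕ (C ∩ ∁ B)       ≡⟨ cong₂ _⊕_ (⁅⁆∩ (x∉p⇒x∈∁p i∉B)) (⊆⇒∩∁≡⊥ C⊆B) ⟩
    ⁅ i ⁆ ⊕ ⊥                       ≡⟨ ⊕-identityʳ ⁅ i ⁆ ⟩
    ⁅ i ⁆                           ∎

X-isBasisOfE : (S : Fin k → F2 n) (B : Subset k) → IsAffineBasis S B → XIsBasisOfE S B
X-isBasisOfE S B basis@(affIndepOnB , _) =
  (λ i i∉B → from (InE⇔kernel S (X S B i)) (X-kernel S B basis i i∉B)) ,
  independent ,
  λ A A∈E → A ∩ ∁ B , p∩q⊆q A (∁ B) , spans A (to (InE⇔kernel S A) A∈E)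
  where
  open KernelBasis (homogenise S) B (affIndepOn⇒independentOn S affIndepOnB)
                   (X S B) (X-kernel S B basis) (X-coordinate S B basis)

hasDim-enumerate : {P : Subset k → Set} (T : Subset k) (Y : Fin k → Subset k) →
                   (∀ i → i ∈ T → P (Y i)) →
                   IndependentOn Y T →
                   (∀ A → P A → ∃ λ J → J ⊆ T × sumSub Y J ≡ A) →
                   HasDim P ∣ T ∣
hasDim-enumerate T Y Y∈P indep span =
  Y ∘ enumerate T ,
  (λ j → Y∈P (enumerate T j) (enumerate-∈ T j)) ,
  independentOn⇒independent Y T indep ,
  λ A A∈P → let J , J⊆T , sum≡A = span A A∈P in
            restrict T J , trans (sym (sumSub-restrict Y T J⊆T)) sum≡A

XIsBasisOfE⇒hasDim : (S : Fin k → F2 n) (B : Subset k) → XIsBasisOfE S B → HasDim (InE S) ∣ ∁ B ∣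
XIsBasisOfE⇒hasDim S B (X∈E , indep , span) =
  hasDim-enumerate (∁ B) (X S B) (λ i i∈∁B → X∈E i (x∈∁p⇒x∉p i∈∁B)) indep span

affineBasis-size≤dim : (S : Fin k → F2 n) (B : Subset k) {d : ℕ} →
                       IsAffineBasis S B → AffDim S d → ∣ B ∣ ≤ suc d
affineBasis-size≤dim S B (affIndepOnB , _) (_ , maximal) =
  maximal ∣ B ∣ (S ∘ enumerate B)
    (from (affIndep⇔independent (S ∘ enumerate B))
          (independentOn⇒independent (homogenise S) B (affIndepOn⇒independentOn S affIndepOnB)))
    (λ j → ⁅ enumerate B j ⁆ , odd-⁅⁆ (enumerate B j) , sumSub-⁅⁆ S (enumerate B j))

-- Write the d + 1 independent points of the span in the affine basis B; their homogenised
-- coordinate vectors in F₂^|B| are then linearly independent.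
dim≤affineBasis-size : (S : Fin k → F2 n) (B : Subset k) {d : ℕ} →
                       IsAffineBasis S B → AffDim S d → suc d ≤ ∣ B ∣
dim≤affineBasis-size S B (_ , _ , inSpan) ((p , affIndep-p , p∈span) , _) =
  independent⇒≤ coordinates
    (independent-factor (homogenise S ∘ enumerate B) coordinates homogenise-p≡
                        (to (affIndep⇔independent p) affIndep-p))
  where
  C = λ j → proj₁ (inSpan (p j) (p∈span j))
  coordinates = λ j → restrict B (C j)

  homogenise-p≡ : ∀ j → homogenise p j ≡ sumSub (homogenise S ∘ enumerate B) (coordinates j)
  homogenise-p≡ j =
    let C⊆B , odd , sum≡ = proj₂ (inSpan (p j) (p∈span j)) in
    trans (sym (homogeneousSum-odd S odd sum≡)) (sumSub-restrict (homogenise S) B C⊆B)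

corollary5p4 : ∀ {n k d : ℕ} (S : Fin k → F2 n) (B : Subset k)
    → Injective _≡_ _≡_ S
    → IsAffineBasis S B
    → AffDim S d
    → XIsBasisOfE S B × HasDim (InE S) (k ∸ suc d)
corollary5p4 {k = k} {d} S B _ basis dim =
  isBasis , subst (HasDim (InE S)) ∣∁B∣≡k∸suc-d (XIsBasisOfE⇒hasDim S B isBasis)
  where
  isBasis = X-isBasisOfE S B basis

  ∣∁B∣≡k∸suc-d : ∣ ∁ B ∣ ≡ k ∸ suc d
  ∣∁B∣≡k∸suc-d = trans (∣∁p∣≡n∸∣p∣ B)
    (cong (k ∸_) (≤-antisym (affineBasis-size≤dim S B basis dim) (dim≤affineBasis-size S B basis dim)))
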